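{- Let $m,n,l$ be positive integers such that $m^2=n^2+nl+l^2$, let $k=n+l$, and let $A=klmn$. Then the three integral points $\bigl(m^2(m^2-n^2),\, m^2(m^2-n^2)^2\bigr)$, $\bigl(m^2(m^2-l^2),\, m^2(m^2-l^2)^2\bigr)$, $\bigl(k^2(k^2-m^2),\, k^2(k^2-m^2)^2\bigr)$ on the curve $C_A: y^2=x^3-A^2x$ lie on a straight line. -}

module Defs where

open import Data.Integer using (ℤ; _+_; _-_; _*_)
open import Data.Product using (_×_; _,_)
open import Relation.Binary.PropositionalEquality using (_≡_)

Point : Set
Point = ℤ × ℤ

OnCurve : ℤ → Point → Set
OnCurve A (x , y) = y * y ≡ x * x * x - A * A * x

Collinear : Point → Point → Point → Set
Collinear (x₁ , y₁) (x₂ , y₂) (x₃ , y₃) =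
  (x₂ - x₁) * (y₃ - y₁) ≡ (y₂ - y₁) * (x₃ - x₁)

{-# OPTIONS --safe #-}
module Submission where

-- With k = n + l the hypothesis gives m² - n² = lk, m² - l² = nk and k² - m² = nl.  Hence the
-- three points have the shape (ad, ad²) with (a, d, a - d) equal to (m², lk, n²), (m², nk, l²)
-- and (k², nl, m²); such a point lies on y² = x³ - A²x exactly when A² = ad²(a - d), which is
-- (klmn)² in all three cases.  All three points lie on the line y = k²(x - m²nl).

open import Defs
open import Data.Integer using (ℤ; _+_; _-_; _*_; _>_; +_)
open import Data.Integer.Tactic.RingSolver using (solve)
open import Data.List using (_∷_; [])
open import Data.Product using (_×_; _,_)
open import Relation.Binary.PropositionalEquality using (_≡_; cong; cong₂; sym; module ≡-Reasoning)
open ≡-Reasoning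

point : ℤ → ℤ → Point
point a d = (a * d , a * (d * d))

point-onCurve : ∀ A a d e → a - d ≡ e → A * A ≡ a * (d * d) * e → OnCurve A (point a d)
point-onCurve A a d e a-d≡e A²≡ = begin
  a * (d * d) * (a * (d * d))
    ≡⟨ solve (a ∷ d ∷ []) ⟩
  a * d * (a * d) * (a * d) - a * (d * d) * (a - d) * (a * d)
    ≡⟨ cong (λ z → a * d * (a * d) * (a * d) - a * (d * d) * z * (a * d)) a-d≡e ⟩
  a * d * (a * d) * (a * d) - a * (d * d) * e * (a * d)
    ≡⟨ cong (λ z → a * d * (a * d) * (a * d) - z * (a * d)) (sym A²≡) ⟩
  a * d * (a * d) * (a * d) - A * A * (a * d)
    ∎

OnLine : ℤ → ℤ → Point → Set
OnLine s t (x , y) = y ≡ s * (x - t)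

point-onLine : ∀ a d s t → a * d * (s - d) ≡ s * t → OnLine s t (point a d)
point-onLine a d s t ≡st = begin
  a * (d * d)                    ≡⟨ solve (a ∷ d ∷ s ∷ []) ⟩
  s * (a * d) - a * d * (s - d)  ≡⟨ cong (s * (a * d) -_) ≡st ⟩
  s * (a * d) - s * t            ≡⟨ solve (a ∷ d ∷ s ∷ t ∷ []) ⟩
  s * (a * d - t)                ∎

collinear-onLine : ∀ s t {P Q R} → OnLine s t P → OnLine s t Q → OnLine s t R → Collinear P Q R
collinear-onLine s t {x₁ , y₁} {x₂ , y₂} {x₃ , y₃} y₁≡ y₂≡ y₃≡ = begin
  (x₂ - x₁) * (y₃ - y₁)                          ≡⟨ cong₂ (λ u v → (x₂ - x₁) * (v - u)) y₁≡ y₃≡ ⟩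
  (x₂ - x₁) * (s * (x₃ - t) - s * (x₁ - t))      ≡⟨ solve (x₁ ∷ x₂ ∷ x₃ ∷ s ∷ t ∷ []) ⟩
  (s * (x₂ - t) - s * (x₁ - t)) * (x₃ - x₁)      ≡⟨ cong₂ (λ u v → (v - u) * (x₃ - x₁)) (sym y₁≡) (sym y₂≡) ⟩
  (y₂ - y₁) * (x₃ - x₁)                          ∎

-- k = n + l is written out: the ring solver treats a defined abbreviation as an opaque constant.
module EisensteinTriple (m n l : ℤ) (h : m * m ≡ n * n + n * l + l * l) where

  m²-n²≡l[n+l] : m * m - n * n ≡ l * (n + l)
  m²-n²≡l[n+l] = begin
    m * m - n * n                  ≡⟨ cong (_- n * n) h ⟩
    n * n + n * l + l * l - n * n  ≡⟨ solve (n ∷ l ∷ []) ⟩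
    l * (n + l)                    ∎

  m²-l²≡n[n+l] : m * m - l * l ≡ n * (n + l)
  m²-l²≡n[n+l] = begin
    m * m - l * l                  ≡⟨ cong (_- l * l) h ⟩
    n * n + n * l + l * l - l * l  ≡⟨ solve (n ∷ l ∷ []) ⟩
    n * (n + l)                    ∎

  [n+l]²-m²≡nl : (n + l) * (n + l) - m * m ≡ n * l
  [n+l]²-m²≡nl = begin
    (n + l) * (n + l) - m * m                   ≡⟨ cong ((n + l) * (n + l) -_) h ⟩
    (n + l) * (n + l) - (n * n + n * l + l * l) ≡⟨ solve (n ∷ l ∷ []) ⟩
    n * l                                       ∎

  A : ℤ
  A = (n + l) * l * m * n

  P₁ P₂ P₃ : Point
  P₁ = point (m * m) (m * m - n * n)
  P₂ = point (m * m) (m * m - l * l)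
  P₃ = point ((n + l) * (n + l)) ((n + l) * (n + l) - m * m)

  onCurve₁ : OnCurve A P₁
  onCurve₁ = point-onCurve A (m * m) (m * m - n * n) (n * n) (solve (m ∷ n ∷ [])) (begin
    (n + l) * l * m * n * ((n + l) * l * m * n)           ≡⟨ solve (m ∷ n ∷ l ∷ []) ⟩
    m * m * ((l * (n + l)) * (l * (n + l))) * (n * n)      ≡⟨ cong (λ d → m * m * (d * d) * (n * n)) (sym m²-n²≡l[n+l]) ⟩
    m * m * ((m * m - n * n) * (m * m - n * n)) * (n * n)  ∎)

  onCurve₂ : OnCurve A P₂
  onCurve₂ = point-onCurve A (m * m) (m * m - l * l) (l * l) (solve (m ∷ l ∷ [])) (begin
    (n + l) * l * m * n * ((n + l) * l * m * n)           ≡⟨ solve (m ∷ n ∷ l ∷ []) ⟩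
    m * m * ((n * (n + l)) * (n * (n + l))) * (l * l)      ≡⟨ cong (λ d → m * m * (d * d) * (l * l)) (sym m²-l²≡n[n+l]) ⟩
    m * m * ((m * m - l * l) * (m * m - l * l)) * (l * l)  ∎)

  onCurve₃ : OnCurve A P₃
  onCurve₃ = point-onCurve A ((n + l) * (n + l)) ((n + l) * (n + l) - m * m) (m * m)
                           (solve (m ∷ n ∷ l ∷ [])) (begin
    (n + l) * l * m * n * ((n + l) * l * m * n)
      ≡⟨ solve (m ∷ n ∷ l ∷ []) ⟩
    (n + l) * (n + l) * ((n * l) * (n * l)) * (m * m)
      ≡⟨ cong (λ d → (n + l) * (n + l) * (d * d) * (m * m)) (sym [n+l]²-m²≡nl) ⟩
    (n + l) * (n + l) * (((n + l) * (n + l) - m * m) * ((n + l) * (n + l) - m * m)) * (m * m)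
      ∎)

  onLine₁ : OnLine ((n + l) * (n + l)) (m * m * (n * l)) P₁
  onLine₁ = point-onLine (m * m) (m * m - n * n) ((n + l) * (n + l)) (m * m * (n * l)) (begin
    m * m * (m * m - n * n) * ((n + l) * (n + l) - (m * m - n * n))
      ≡⟨ cong (λ d → m * m * d * ((n + l) * (n + l) - d)) m²-n²≡l[n+l] ⟩
    m * m * (l * (n + l)) * ((n + l) * (n + l) - l * (n + l))
      ≡⟨ solve (m ∷ n ∷ l ∷ []) ⟩
    (n + l) * (n + l) * (m * m * (n * l))
      ∎)

  onLine₂ : OnLine ((n + l) * (n + l)) (m * m * (n * l)) P₂
  onLine₂ = point-onLine (m * m) (m * m - l * l) ((n + l) * (n + l)) (m * m * (n * l)) (begin
    m * m * (m * m - l * l) * ((n + l) * (n + l) - (m * m - l * l))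
      ≡⟨ cong (λ d → m * m * d * ((n + l) * (n + l) - d)) m²-l²≡n[n+l] ⟩
    m * m * (n * (n + l)) * ((n + l) * (n + l) - n * (n + l))
      ≡⟨ solve (m ∷ n ∷ l ∷ []) ⟩
    (n + l) * (n + l) * (m * m * (n * l))
      ∎)

  onLine₃ : OnLine ((n + l) * (n + l)) (m * m * (n * l)) P₃
  onLine₃ = point-onLine ((n + l) * (n + l)) ((n + l) * (n + l) - m * m) ((n + l) * (n + l)) (m * m * (n * l)) (begin
    (n + l) * (n + l) * ((n + l) * (n + l) - m * m) * ((n + l) * (n + l) - ((n + l) * (n + l) - m * m))
      ≡⟨ solve (m ∷ n ∷ l ∷ []) ⟩
    (n + l) * (n + l) * ((n + l) * (n + l) - m * m) * (m * m)
      ≡⟨ cong (λ d → (n + l) * (n + l) * d * (m * m)) [n+l]²-m²≡nl ⟩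
    (n + l) * (n + l) * (n * l) * (m * m)
      ≡⟨ solve (m ∷ n ∷ l ∷ []) ⟩
    (n + l) * (n + l) * (m * m * (n * l))
      ∎)

  collinear : Collinear P₁ P₂ P₃
  collinear = collinear-onLine ((n + l) * (n + l)) (m * m * (n * l)) {P₁} {P₂} {P₃} onLine₁ onLine₂ onLine₃

mainTheorem3 : (m n l : ℤ) → m > + 0 → n > + 0 → l > + 0
    → m * m ≡ n * n + n * l + l * l
    → let k = n + l
          A = k * l * m * n
          P₁ = (m * m * (m * m - n * n) , m * m * ((m * m - n * n) * (m * m - n * n)))
          P₂ = (m * m * (m * m - l * l) , m * m * ((m * m - l * l) * (m * m - l * l)))
          P₃ = (k * k * (k * k - m * m) , k * k * ((k * k - m * m) * (k * k - m * m)))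
      in (OnCurve A P₁ × OnCurve A P₂ × OnCurve A P₃) × Collinear P₁ P₂ P₃
mainTheorem3 m n l _ _ _ h =
  (onCurve₁ , onCurve₂ , onCurve₃) , collinear
  where open EisensteinTriple m n l h
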